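{- Let $G$ be a graph with $m$ edges and let $k\ge 0$ be an integer. Then $$\alpha_{k-reg}(L(G))\ge \frac{m^{1/3}}{4\chi_k(L(G))}.$$
   Context: All graphs are finite, simple and undirected. $L(G)$ is the line graph of $G$. For a graph $H$, $D_i(H)$ denotes the set of vertices of degree $i$ in $H$. For an integer $k\ge 0$, a set $S\subseteq V(H)$ is $k$-independent if $H[S]$ has maximum degree at most $k$; a regular $k$-independent set is a $k$-independent set contained in some $D_i(H)$; $\alpha_{k-reg}(H)$ is the maximum cardinality of a regular $k$-independent set of $H$. The $k$-chromatic number $\chi_k(H)$ is the minimum number of colors in a coloring of $V(H)$ such that each color class induces a subgraph of maximum degree at most $k$. -}

module Defs where

open import Data.Nat using (ℕ; _≤_; _<?_)
open import Data.Bool using (Bool; true; false; _∧_; _∨_; not; if_then_else_)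
open import Data.Fin using (Fin; toℕ; _≟_)
open import Data.Fin.Subset using (Subset; _∈_; _∩_; ∣_∣)
open import Data.Vec using (tabulate)
open import Data.List using (List; []; _∷_; length; lookup; concatMap; allFin)
open import Data.Product using (_×_; _,_; Σ; ∃; proj₁; proj₂)
open import Relation.Binary.PropositionalEquality using (_≡_)
open import Relation.Nullary.Decidable using (⌊_⌋)

record RawGraph : Set where
  field
    n   : ℕ
    adj : Fin n → Fin n → Bool
open RawGraph public

record Graph : Set where
  field
    raw    : RawGraph
    sym    : ∀ u v → adj raw u v ≡ adj raw v u
    irrefl : ∀ v → adj raw v v ≡ false
open Graph public

nbr : (H : RawGraph) → Fin (n H) → Subset (n H)
nbr H v = tabulate (adj H v)

deg : (H : RawGraph) → Fin (n H) → ℕ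
deg H v = ∣ nbr H v ∣

degIn : (H : RawGraph) → Subset (n H) → Fin (n H) → ℕ
degIn H S v = ∣ nbr H v ∩ S ∣

InD : (H : RawGraph) → ℕ → Fin (n H) → Set
InD H i v = deg H v ≡ i

KIndependent : (H : RawGraph) → ℕ → Subset (n H) → Set
KIndependent H k S = ∀ v → v ∈ S → degIn H S v ≤ k

RegKIndependent : (H : RawGraph) → ℕ → Subset (n H) → Set
RegKIndependent H k S = KIndependent H k S × ∃ λ i → ∀ v → v ∈ S → InD H i v

IsAlphaKReg : (H : RawGraph) → ℕ → ℕ → Set
IsAlphaKReg H k a =
  (Σ (Subset (n H)) λ S → RegKIndependent H k S × ∣ S ∣ ≡ a)
  × (∀ S → RegKIndependent H k S → ∣ S ∣ ≤ a)

colourClass : (H : RawGraph) {c : ℕ} → (Fin (n H) → Fin c) → Fin c → Subset (n H)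
colourClass H col j = tabulate (λ u → ⌊ col u ≟ j ⌋)

KColouring : (H : RawGraph) → ℕ → (c : ℕ) → (Fin (n H) → Fin c) → Set
KColouring H k c col = ∀ j → KIndependent H k (colourClass H col j)

IsChiK : (H : RawGraph) → ℕ → ℕ → Set
IsChiK H k c =
  (Σ (Fin (n H) → Fin c) λ col → KColouring H k c col)
  × (∀ c' → (col : Fin (n H) → Fin c') → KColouring H k c' col → c ≤ c')

-- edges of G: pairs (u , v) with u < v and u ~ v, each edge listed once
edgeList : (G : Graph) → List (Fin (n (raw G)) × Fin (n (raw G)))
edgeList G = concatMap (λ u → concatMap (λ v →
    if ⌊ toℕ u <? toℕ v ⌋ ∧ adj (raw G) u v then (u , v) ∷ [] else [])
    (allFin _)) (allFin _)

numEdges : Graph → ℕ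
numEdges G = length (edgeList G)

-- the line graph L(G): vertices are the edges of G (indexed by Fin m),
-- two distinct edges adjacent iff they share an endpoint
lineGraph : Graph → RawGraph
lineGraph G = record
  { n   = numEdges G
  ; adj = λ e f → not ⌊ e ≟ f ⌋ ∧ share (lookup (edgeList G) e) (lookup (edgeList G) f)
  }
  where
  share : Fin (n (raw G)) × Fin (n (raw G)) → Fin (n (raw G)) × Fin (n (raw G)) → Bool
  share (a , b) (c , d) = ⌊ a ≟ c ⌋ ∨ ⌊ a ≟ d ⌋ ∨ ⌊ b ≟ c ⌋ ∨ ⌊ b ≟ d ⌋

-- Put B = χ_k(L(G)) · α_{k-reg}(L(G)). A colour class of a k-colouring meets each degree class
-- D_i(L(G)) in a regular k-independent set, so |D_i(L(G))| ≤ B. Let e = uv be an edge of maximum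
-- degree Δ in L(G); then m ≤ (Δ + 1) B. For an edge f at a vertex w, deg f + 1 = d(w) + r_w(f),
-- where r_w(f) counts the neighbours of f off the star of w, so the edges at w with a given value of
-- r_w all lie in one degree class and at most t B of them have r_w < t. An edge off the star of w
-- meets at most four edges of it, so r_w sums to at most 4m over the star and at most 4m / t of its
-- edges have r_w ≥ t. Hence t d(w) ≤ t² B + 4m; taking t = 16 B at both ends of e and using
-- Δ + 2 ≤ d(u) + d(v) gives m ≤ 64 B³.
module Submission where

open import Defs
  using (RawGraph; n; adj; Graph; raw; nbr; deg; KIndependent; RegKIndependent; KColouring; colourClass;
         IsChiK; IsAlphaKReg; edgeList; numEdges; lineGraph)

open import Data.Bool using (Bool; true; false; T; T?; _∧_; _∨_; not; if_then_else_)
open import Data.Bool.Properties using (T-∧; T-∨; T-≡)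
open import Data.Empty using (⊥-elim)
open import Data.Fin using (Fin; zero; suc; _≟_)
import Data.Fin.Properties as Fin
open import Data.Fin.Subset using (Subset; _∈_; _⊆_; _∩_; ∣_∣)
open import Data.Fin.Subset.Properties using (p⊆q⇒∣p∣≤∣q∣; x∈p∩q⁺; x∈p∩q⁻)
open import Data.List
  using (List; []; _∷_; _++_; length; lookup; map; concatMap; filter; cartesianProduct; allFin)
open import Data.List.Extrema.Nat using (argmax; f[xs]≤f[argmax])
open import Data.List.Membership.Propositional using () renaming (_∈_ to _∈ₗ_)
open import Data.List.Membership.Propositional.Properties using (∈-lookup; ∈-allFin)
open import Data.List.Properties using (filter-++)
import Data.List.Relation.Unary.All as All
open import Data.List.Relation.Unary.AllPairs using (_∷_)
open import Data.List.Relation.Unary.Any using (here; there)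
open import Data.List.Relation.Unary.Any.Properties using (¬Any[])
open import Data.List.Relation.Unary.Unique.Propositional using (Unique)
open import Data.List.Relation.Unary.Unique.Propositional.Properties
  using (filter⁺; cartesianProduct⁺; allFin⁺)
open import Data.Nat using (ℕ; zero; suc; pred; _+_; _*_; _^_; _≤_; z≤n; s≤s; _≡ᵇ_; _<ᵇ_)
open import Data.Nat.Properties
  using (+-*-semiring; ≤-refl; ≤-reflexive; ≤-trans; ≤-antisym; module ≤-Reasoning;
         n≤0⇒n≡0; n≮0; ≮⇒≥; m<1+n⇒m<n∨m≡n; m≤m+n; <ᵇ⇒<; <⇒<ᵇ; ≡ᵇ⇒≡; ≡⇒≡ᵇ;
         +-comm; +-suc; *-assoc; *-zeroʳ; *-identityˡ; *-identityʳ; *-distribˡ-+;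
         +-mono-≤; +-monoʳ-≤; *-monoʳ-≤; +-cancelˡ-≤; *-cancelˡ-≤)
open import Data.Nat.Tactic.RingSolver using (solve-∀)
open import Data.Product using (_×_; _,_; proj₁; proj₂; ∃-syntax)
open import Data.Product.Properties using (≡-dec)
open import Data.Sum using (_⊎_; inj₁; inj₂)
open import Data.Vec using (tabulate)
open import Data.Vec.Functional using (removeAt)
open import Data.Vec.Properties using (lookup∘tabulate; []=⇒lookup; lookup⇒[]=)
open import Function using (_∘_; Equivalence; Injective; _⇔_; mk⇔)
open import Relation.Binary.Definitions using (DecidableEquality)
open import Relation.Binary.PropositionalEquality
  using (_≡_; _≢_; refl; sym; trans; cong; cong₂; subst; module ≡-Reasoning)
open import Relation.Nullary using (¬_)
open import Relation.Nullary.Decidable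
  using (⌊_⌋; _⊎-dec_; toWitness; fromWitness; toWitnessFalse; fromWitnessFalse)

open import Algebra.Properties.Semiring.Sum +-*-semiring
  using (sum; sum-syntax; ∑-comm; ∑-distrib-+; sum-cong-≗; sum-remove; *-distribˡ-sum)

private
  variable
    m : ℕ

-- Counting in Fin m

T-∧⁺ : ∀ x {y} → T x × T y → T (x ∧ y)
T-∧⁺ x = Equivalence.from (T-∧ {x})

T-∧⁻ : ∀ x {y} → T (x ∧ y) → T x × T y
T-∧⁻ x = Equivalence.to (T-∧ {x})

T-∨⁺ : ∀ x {y} → T x ⊎ T y → T (x ∨ y)
T-∨⁺ x = Equivalence.from (T-∨ {x})

T-∨⁻ : ∀ x {y} → T (x ∨ y) → T x ⊎ T y
T-∨⁻ x = Equivalence.to (T-∨ {x})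

indicator : Bool → ℕ
indicator true  = 1
indicator false = 0

count : (Fin m → Bool) → ℕ
count {m} p = ∑[ i < m ] indicator (p i)

sum-mono : {f g : Fin m → ℕ} → (∀ i → f i ≤ g i) → sum f ≤ sum g
sum-mono {zero}  f≤g = z≤n
sum-mono {suc m} f≤g = +-mono-≤ (f≤g zero) (sum-mono (f≤g ∘ suc))

sum-const : ∀ m x → ∑[ i < m ] x ≡ m * x
sum-const zero    x = refl
sum-const (suc m) x = cong (x +_) (sum-const m x)

count-mono : {p q : Fin m → Bool} → (∀ i → T (p i) → T (q i)) → count p ≤ count q
count-mono {p = p} {q} p⇒q = sum-mono (λ i → pointwise (p i) (q i) (p⇒q i))
  where
  pointwise : ∀ x y → (T x → T y) → indicator x ≤ indicator y
  pointwise false _     _   = z≤n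
  pointwise true  true  _   = ≤-refl
  pointwise true  false x⇒y = ⊥-elim (x⇒y _)

count-none : {p : Fin m → Bool} → (∀ i → ¬ T (p i)) → count p ≡ 0
count-none {m} none =
  n≤0⇒n≡0 (≤-trans (count-mono none) (≤-reflexive (trans (sum-const m 0) (*-zeroʳ m))))

count-cong : {p q : Fin m → Bool} → (∀ i → T (p i) → T (q i)) → (∀ i → T (q i) → T (p i)) →
             count p ≡ count q
count-cong p⇒q q⇒p = ≤-antisym (count-mono p⇒q) (count-mono q⇒p)

count-true : count {m} (λ _ → true) ≡ m
count-true {m} = trans (sum-const m 1) (*-identityʳ m)

count-∨ : (p q : Fin m → Bool) → count (λ i → p i ∨ q i) ≤ count p + count q
count-∨ {m} p q =
  ≤-trans (sum-mono {m} (λ i → pointwise (p i) (q i)))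
          (≤-reflexive (∑-distrib-+ (indicator ∘ p) (indicator ∘ q)))
  where
  pointwise : ∀ x y → indicator (x ∨ y) ≤ indicator x + indicator y
  pointwise true  _ = s≤s z≤n
  pointwise false _ = ≤-refl

count-split : (p b : Fin m → Bool) → count p ≡ count (λ i → p i ∧ b i) + count (λ i → p i ∧ not (b i))
count-split p b = trans (sum-cong-≗ (λ i → pointwise (p i) (b i)))
  (∑-distrib-+ (λ i → indicator (p i ∧ b i)) (λ i → indicator (p i ∧ not (b i))))
  where
  pointwise : ∀ x y → indicator x ≡ indicator (x ∧ y) + indicator (x ∧ not y)
  pointwise true  true  = refl
  pointwise true  false = refl
  pointwise false _     = refl

count-witness : {p : Fin m → Bool} (i : Fin m) → T (p i) → 1 ≤ count p
count-witness {suc m} {p} i pi = begin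
  1                                                  ≡⟨ cong indicator (Equivalence.to T-≡ pi) ⟨
  indicator (p i)                                    ≤⟨ m≤m+n _ _ ⟩
  indicator (p i) + sum (removeAt (indicator ∘ p) i) ≡⟨ sum-remove (indicator ∘ p) ⟨
  count p                                            ∎
  where open ≤-Reasoning

count-≤1 : {p : Fin m → Bool} → (∀ i j → T (p i) → T (p j) → i ≡ j) → count p ≤ 1
count-≤1 {zero} _ = z≤n
count-≤1 {suc m} {p} unique with p zero in p0
... | true  = ≤-reflexive (cong suc (count-none {m} {p ∘ suc} only-zero))
  where
  only-zero : ∀ i → ¬ T (p (suc i))
  only-zero i pi = Fin.0≢1+n (unique zero (suc i) (Equivalence.from T-≡ p0) pi)
... | false = count-≤1 {m} {p ∘ suc} (λ i j pi pj → Fin.suc-injective (unique (suc i) (suc j) pi pj))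

count-≡1 : {p : Fin m → Bool} (i : Fin m) → T (p i) → (∀ j → T (p j) → j ≡ i) → count p ≡ 1
count-≡1 i pi only-i =
  ≤-antisym (count-≤1 (λ j k pj pk → trans (only-i j pj) (sym (only-i k pk)))) (count-witness i pi)

count-remove : {p : Fin m → Bool} (i : Fin m) → T (p i) →
               count p ≡ suc (count (λ j → p j ∧ not ⌊ j ≟ i ⌋))
count-remove {m} {p} i pi = begin
  count p
    ≡⟨ count-split p (λ j → ⌊ j ≟ i ⌋) ⟩
  count (λ j → p j ∧ ⌊ j ≟ i ⌋) + rest
    ≡⟨ cong (_+ rest) (count-≡1 i (T-∧⁺ (p i) (pi , fromWitness refl)) only-i) ⟩
  suc rest
    ∎
  where
  open ≡-Reasoning
  rest = count (λ j → p j ∧ not ⌊ j ≟ i ⌋)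
  only-i : ∀ j → T (p j ∧ ⌊ j ≟ i ⌋) → j ≡ i
  only-i j pj = toWitness (proj₂ (T-∧⁻ (p j) pj))

count-partition : (p : Fin m → Bool) {c : ℕ} (col : Fin m → Fin c) →
                  count p ≡ ∑[ j < c ] count (λ i → p i ∧ ⌊ col i ≟ j ⌋)
count-partition p {c} col = begin
  count p
    ≡⟨ sum-cong-≗ (λ i → pointwise (p i) (col i)) ⟩
  ∑[ i < _ ] ∑[ j < c ] indicator (p i ∧ ⌊ col i ≟ j ⌋)
    ≡⟨ ∑-comm (λ i j → indicator (p i ∧ ⌊ col i ≟ j ⌋)) ⟩
  ∑[ j < c ] count (λ i → p i ∧ ⌊ col i ≟ j ⌋)
    ∎
  where
  open ≡-Reasoning
  pointwise : ∀ x (k : Fin c) → indicator x ≡ ∑[ j < c ] indicator (x ∧ ⌊ k ≟ j ⌋)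
  pointwise true  k = sym (count-≡1 k (fromWitness refl) (λ j kj → sym (toWitness kj)))
  pointwise false k = sym (trans (sum-const c 0) (*-zeroʳ c))

indicator-*-count : ∀ x (q : Fin m → Bool) → indicator x * count q ≡ count (λ i → x ∧ q i)
indicator-*-count true  q = *-identityˡ (count q)
indicator-*-count false q = sym (count-none {p = λ i → false ∧ q i} (λ _ ()))

count-<-layers : (p : Fin m → Bool) (h : Fin m → ℕ) {B : ℕ} →
                 (∀ s → count (λ i → p i ∧ (h i ≡ᵇ s)) ≤ B) →
                 ∀ t → count (λ i → p i ∧ (h i <ᵇ t)) ≤ t * B
count-<-layers p h layer zero =
  ≤-reflexive (count-none (λ i pi → n≮0 (<ᵇ⇒< (h i) 0 (proj₂ (T-∧⁻ (p i) pi)))))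
count-<-layers p h {B} layer (suc t) = begin
  count (λ i → p i ∧ (h i <ᵇ suc t))  ≤⟨ count-mono below-or-at ⟩
  count (λ i → below i ∨ at i)        ≤⟨ count-∨ below at ⟩
  count below + count at              ≤⟨ +-mono-≤ (count-<-layers p h layer t) (layer t) ⟩
  t * B + B                           ≡⟨ +-comm (t * B) B ⟩
  suc t * B                           ∎
  where
  open ≤-Reasoning
  below at : Fin _ → Bool
  below i = p i ∧ (h i <ᵇ t)
  at    i = p i ∧ (h i ≡ᵇ t)
  below-or-at : ∀ i → T (p i ∧ (h i <ᵇ suc t)) → T (below i ∨ at i)
  below-or-at i pi with T-∧⁻ (p i) pi
  ... | pi′ , hi<1+t with m<1+n⇒m<n∨m≡n (<ᵇ⇒< (h i) (suc t) hi<1+t)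
  ...   | inj₁ hi<t = T-∨⁺ (below i) (inj₁ (T-∧⁺ (p i) (pi′ , <⇒<ᵇ hi<t)))
  ...   | inj₂ hi≡t = T-∨⁺ (below i) (inj₂ (T-∧⁺ (p i) (pi′ , ≡⇒≡ᵇ (h i) t hi≡t)))

size-≤-layers : (h : Fin m → ℕ) {Δ B : ℕ} → (∀ i → h i ≤ Δ) →
                (∀ s → count (λ i → h i ≡ᵇ s) ≤ B) → m ≤ suc Δ * B
size-≤-layers {m} h {Δ} {B} h≤Δ layer = begin
  m                                    ≡⟨ count-true ⟨
  count {m} (λ _ → true)               ≤⟨ count-mono (λ i _ → <⇒<ᵇ (s≤s (h≤Δ i))) ⟩
  count (λ i → true ∧ (h i <ᵇ suc Δ))  ≤⟨ count-<-layers (λ _ → true) h layer (suc Δ) ⟩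
  suc Δ * B                            ∎
  where open ≤-Reasoning

count-≥-markov : (p : Fin m → Bool) (h : Fin m → ℕ) (t : ℕ) →
                 t * count (λ i → p i ∧ not (h i <ᵇ t)) ≤ ∑[ i < m ] (indicator (p i) * h i)
count-≥-markov {m} p h t = begin
  t * count above                     ≡⟨ *-distribˡ-sum t (indicator ∘ above) ⟩
  ∑[ i < m ] (t * indicator (above i))  ≤⟨ sum-mono (λ i → pointwise (p i) (h i)) ⟩
  ∑[ i < m ] (indicator (p i) * h i)    ∎
  where
  open ≤-Reasoning
  above : Fin m → Bool
  above i = p i ∧ not (h i <ᵇ t)
  pointwise : ∀ x y → t * indicator (x ∧ not (y <ᵇ t)) ≤ indicator x * y
  pointwise false y = ≤-reflexive (*-zeroʳ t)
  pointwise true  y with y <ᵇ t in y<t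
  ... | true  = ≤-trans (≤-reflexive (*-zeroʳ t)) z≤n
  ... | false = begin
    t * 1  ≡⟨ *-identityʳ t ⟩
    t      ≤⟨ ≮⇒≥ (λ y<t′ → subst T y<t (<⇒<ᵇ y<t′)) ⟩
    y      ≡⟨ *-identityˡ y ⟨
    1 * y  ∎

count-≤-length : {A : Set} (_≟ₐ_ : DecidableEquality A) (φ : Fin m → A) → Injective _≡_ _≡_ φ →
                 {p : Fin m → Bool} (xs : List A) → (∀ i → T (p i) → φ i ∈ₗ xs) →
                 count p ≤ length xs
count-≤-length _≟ₐ_ φ φ-inj []       within = ≤-reflexive (count-none (λ i pi → ¬Any[] (within i pi)))
count-≤-length _≟ₐ_ φ φ-inj {p} (x ∷ xs) within = begin
  count p
    ≡⟨ count-split p (λ i → ⌊ φ i ≟ₐ x ⌋) ⟩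
  count (λ i → p i ∧ ⌊ φ i ≟ₐ x ⌋) + count (λ i → p i ∧ not ⌊ φ i ≟ₐ x ⌋)
    ≤⟨ +-mono-≤ (count-≤1 at-x) (count-≤-length _≟ₐ_ φ φ-inj xs within-xs) ⟩
  suc (length xs)
    ∎
  where
  open ≤-Reasoning
  at-x : ∀ i j → T (p i ∧ ⌊ φ i ≟ₐ x ⌋) → T (p j ∧ ⌊ φ j ≟ₐ x ⌋) → i ≡ j
  at-x i j pi pj = φ-inj (trans (hits-x i pi) (sym (hits-x j pj)))
    where
    hits-x : ∀ i → T (p i ∧ ⌊ φ i ≟ₐ x ⌋) → φ i ≡ x
    hits-x i pi = toWitness (proj₂ (T-∧⁻ (p i) pi))
  within-xs : ∀ i → T (p i ∧ not ⌊ φ i ≟ₐ x ⌋) → φ i ∈ₗ xs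
  within-xs i pi with T-∧⁻ (p i) pi
  ... | pi′ , φi≢x with within i pi′
  ...   | here φi≡x = ⊥-elim (toWitnessFalse φi≢x φi≡x)
  ...   | there φi∈xs = φi∈xs

maximum-or-empty : (h : Fin m → ℕ) → m ≡ 0 ⊎ ∃[ i ] ∀ j → h j ≤ h i
maximum-or-empty {zero}  h = inj₁ refl
maximum-or-empty {suc m} h =
  inj₂ (argmax h zero (allFin _) , λ j → All.lookup (f[xs]≤f[argmax] {f = h} zero (allFin _)) (∈-allFin j))

-- Degree classes

∣tabulate∣≡count : (p : Fin m → Bool) → ∣ tabulate p ∣ ≡ count p
∣tabulate∣≡count {zero}  p = refl
∣tabulate∣≡count {suc m} p with p zero
... | true  = cong suc (∣tabulate∣≡count (p ∘ suc))
... | false = ∣tabulate∣≡count (p ∘ suc)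

∈tabulate⇒T : (p : Fin m → Bool) {i : Fin m} → i ∈ tabulate p → T (p i)
∈tabulate⇒T p {i} i∈p = Equivalence.from T-≡ (trans (sym (lookup∘tabulate p i)) ([]=⇒lookup i∈p))

T⇒∈tabulate : (p : Fin m → Bool) {i : Fin m} → T (p i) → i ∈ tabulate p
T⇒∈tabulate p {i} pi = lookup⇒[]= i (tabulate p) (trans (lookup∘tabulate p i) (Equivalence.to T-≡ pi))

KIndependent-⊆ : (H : RawGraph) {k : ℕ} {S S′ : Subset (n H)} → S ⊆ S′ →
                 KIndependent H k S′ → KIndependent H k S
KIndependent-⊆ H {S = S} {S′} S⊆S′ indep v v∈S =
  ≤-trans (p⊆q⇒∣p∣≤∣q∣ ∩-mono) (indep v (S⊆S′ v∈S))
  where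
  ∩-mono : ∀ {u} → u ∈ nbr H v ∩ S → u ∈ nbr H v ∩ S′
  ∩-mono u∈ = let u∈N , u∈S = x∈p∩q⁻ (nbr H v) S u∈ in x∈p∩q⁺ (u∈N , S⊆S′ u∈S)

degreeClass-bound : (H : RawGraph) {k c a : ℕ} {col : Fin (n H) → Fin c} → KColouring H k c col →
                    (∀ S → RegKIndependent H k S → ∣ S ∣ ≤ a) →
                    ∀ i → count (λ v → deg H v ≡ᵇ i) ≤ c * a
degreeClass-bound H {k} {c} {a} {col} colouring α-max i = begin
  count (λ v → deg H v ≡ᵇ i)  ≡⟨ count-partition (λ v → deg H v ≡ᵇ i) col ⟩
  ∑[ j < c ] count (piece j)  ≤⟨ sum-mono bounded ⟩
  ∑[ j < c ] a                ≡⟨ sum-const c a ⟩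
  c * a                       ∎
  where
  open ≤-Reasoning
  piece : Fin c → Fin (n H) → Bool
  piece j v = (deg H v ≡ᵇ i) ∧ ⌊ col v ≟ j ⌋
  piece⁻ : ∀ {j v} → v ∈ tabulate (piece j) → deg H v ≡ i × T ⌊ col v ≟ j ⌋
  piece⁻ {j} {v} v∈ with T-∧⁻ (deg H v ≡ᵇ i) (∈tabulate⇒T (piece j) v∈)
  ... | degᵥ≡i , colᵥ≡j = ≡ᵇ⇒≡ _ _ degᵥ≡i , colᵥ≡j
  regular : ∀ j → RegKIndependent H k (tabulate (piece j))
  regular j = KIndependent-⊆ H inClass (colouring j) , i , λ v v∈ → proj₁ (piece⁻ v∈)
    where
    inClass : tabulate (piece j) ⊆ colourClass H col j
    inClass v∈ = T⇒∈tabulate (λ u → ⌊ col u ≟ j ⌋) (proj₂ (piece⁻ v∈))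
  bounded : ∀ j → count (piece j) ≤ a
  bounded j = subst (_≤ a) (∣tabulate∣≡count (piece j)) (α-max _ (regular j))

cube-bound : ∀ {N Δ B} → N ≤ suc Δ * B → 16 * B * (2 + Δ) ≤ 512 * (B * B * B) + 8 * N →
             N ≤ 64 * (B * B * B)
cube-bound {N} {Δ} {B} N≤ stars = *-cancelˡ-≤ 8 (begin
  8 * N                ≤⟨ *-monoʳ-≤ 8 N≤ ⟩
  X                    ≤⟨ ≤-trans (m≤m+n X (16 * B)) (+-cancelˡ-≤ X _ _ twice) ⟩
  512 * (B * B * B)    ≡⟨ *-assoc 8 64 (B * B * B) ⟩
  8 * (64 * (B * B * B)) ∎)
  where
  open ≤-Reasoning
  X = 8 * (suc Δ * B)
  twice : X + (X + 16 * B) ≤ X + 512 * (B * B * B)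
  twice = begin
    X + (X + 16 * B)          ≡⟨ regroup B Δ ⟩
    16 * B * (2 + Δ)          ≤⟨ stars ⟩
    512 * (B * B * B) + 8 * N ≤⟨ +-monoʳ-≤ (512 * (B * B * B)) (*-monoʳ-≤ 8 N≤) ⟩
    512 * (B * B * B) + X     ≡⟨ +-comm _ X ⟩
    X + 512 * (B * B * B)     ∎
    where
    regroup : ∀ B Δ → 8 * (suc Δ * B) + (8 * (suc Δ * B) + 16 * B) ≡ 16 * B * (2 + Δ)
    regroup = solve-∀

-- The line graph

lookup-injective : {A : Set} {xs : List A} → Unique xs →
                   {i j : Fin (length xs)} → lookup xs i ≡ lookup xs j → i ≡ j
lookup-injective {xs = _ ∷ _}  _          {zero}  {zero}  _  = refl
lookup-injective {xs = _ ∷ xs} (x∉ ∷ _)   {zero}  {suc j} eq = ⊥-elim (All.lookup x∉ (∈-lookup j) eq)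
lookup-injective {xs = _ ∷ xs} (x∉ ∷ _)   {suc i} {zero}  eq = ⊥-elim (All.lookup x∉ (∈-lookup i) (sym eq))
lookup-injective {xs = _ ∷ xs} (_ ∷ uniq) {suc i} {suc j} eq = cong suc (lookup-injective uniq eq)

concatMap-guard≡filter : {A B : Set} (b : A × B → Bool) (xs : List A) (ys : List B) →
  concatMap (λ x → concatMap (λ y → if b (x , y) then (x , y) ∷ [] else []) ys) xs ≡
  filter (T? ∘ b) (cartesianProduct xs ys)
concatMap-guard≡filter b []       ys = refl
concatMap-guard≡filter b (x ∷ xs) ys = begin
  row ys ++ concatMap (λ x → concatMap (λ y → if b (x , y) then (x , y) ∷ [] else []) ys) xs
    ≡⟨ cong₂ _++_ (row≡filter ys) (concatMap-guard≡filter b xs ys) ⟩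
  filter (T? ∘ b) (map (x ,_) ys) ++ filter (T? ∘ b) (cartesianProduct xs ys)
    ≡⟨ filter-++ (T? ∘ b) (map (x ,_) ys) (cartesianProduct xs ys) ⟨
  filter (T? ∘ b) (cartesianProduct (x ∷ xs) ys)
    ∎
  where
  open ≡-Reasoning
  row : List _ → List _
  row = concatMap (λ y → if b (x , y) then (x , y) ∷ [] else [])
  row≡filter : ∀ ys → row ys ≡ filter (T? ∘ b) (map (x ,_) ys)
  row≡filter []       = refl
  row≡filter (y ∷ ys) with b (x , y)
  ... | true  = cong ((x , y) ∷_) (row≡filter ys)
  ... | false = row≡filter ys

_∈ₚ_ : {A : Set} → A → A × A → Set
x ∈ₚ (a , b) = x ≡ a ⊎ x ≡ b

joins : {A : Set} → A → A × A → List (A × A)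
joins w (a , b) = (w , a) ∷ (a , w) ∷ (w , b) ∷ (b , w) ∷ []

∈ₚ-both : {A : Set} {x y : A} {p : A × A} → x ≢ y → x ∈ₚ p → y ∈ₚ p →
          p ≡ (x , y) ⊎ p ≡ (y , x)
∈ₚ-both x≢y (inj₁ refl) (inj₁ refl) = ⊥-elim (x≢y refl)
∈ₚ-both x≢y (inj₁ refl) (inj₂ refl) = inj₁ refl
∈ₚ-both x≢y (inj₂ refl) (inj₁ refl) = inj₂ refl
∈ₚ-both x≢y (inj₂ refl) (inj₂ refl) = ⊥-elim (x≢y refl)

module _ (G : Graph) where

  private
    V = Fin (n (raw G))
    E = Fin (numEdges G)
    L = lineGraph G

  ends : E → V × V
  ends = lookup (edgeList G)

  edgeList-unique : Unique (edgeList G)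
  edgeList-unique = subst Unique (sym (concatMap-guard≡filter _ (allFin _) (allFin _)))
    (filter⁺ (T? ∘ _) (cartesianProduct⁺ (allFin⁺ _) (allFin⁺ _)))

  ends-injective : Injective _≡_ _≡_ ends
  ends-injective = lookup-injective edgeList-unique

  star : V → E → Bool
  star w f = ⌊ w ≟ proj₁ (ends f) ⊎-dec w ≟ proj₂ (ends f) ⌋

  adjacent⇔ : ∀ {e f} → T (adj L e f) ⇔ (e ≢ f × ∃[ x ] x ∈ₚ ends e × x ∈ₚ ends f)
  adjacent⇔ {e} {f} = mk⇔ to from
    where
    a = proj₁ (ends e)
    b = proj₂ (ends e)
    c = proj₁ (ends f)
    d = proj₂ (ends f)
    to : T (adj L e f) → e ≢ f × ∃[ x ] x ∈ₚ ends e × x ∈ₚ ends f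
    to adj-ef with T-∧⁻ (not ⌊ e ≟ f ⌋) adj-ef
    ... | e≢f , share = toWitnessFalse e≢f , shared (T-∨⁻ ⌊ a ≟ c ⌋ share)
      where
      shared : T ⌊ a ≟ c ⌋ ⊎ T (⌊ a ≟ d ⌋ ∨ ⌊ b ≟ c ⌋ ∨ ⌊ b ≟ d ⌋) →
               ∃[ x ] x ∈ₚ ends e × x ∈ₚ ends f
      shared (inj₁ a≡c) = a , inj₁ refl , inj₁ (toWitness a≡c)
      shared (inj₂ rest) with T-∨⁻ ⌊ a ≟ d ⌋ rest
      ... | inj₁ a≡d = a , inj₁ refl , inj₂ (toWitness a≡d)
      ... | inj₂ rest′ with T-∨⁻ ⌊ b ≟ c ⌋ rest′
      ...   | inj₁ b≡c = b , inj₂ refl , inj₁ (toWitness b≡c)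
      ...   | inj₂ b≡d = b , inj₂ refl , inj₂ (toWitness b≡d)
    from : e ≢ f × ∃[ x ] x ∈ₚ ends e × x ∈ₚ ends f → T (adj L e f)
    from (e≢f , x , x∈e , x∈f) = T-∧⁺ (not ⌊ e ≟ f ⌋) (fromWitnessFalse e≢f , share x∈e x∈f)
      where
      via-b : ∀ {y} → T y → T (⌊ a ≟ c ⌋ ∨ ⌊ a ≟ d ⌋ ∨ y)
      via-b ty = T-∨⁺ ⌊ a ≟ c ⌋ (inj₂ (T-∨⁺ ⌊ a ≟ d ⌋ (inj₂ ty)))
      share : x ∈ₚ ends e → x ∈ₚ ends f → T (⌊ a ≟ c ⌋ ∨ ⌊ a ≟ d ⌋ ∨ ⌊ b ≟ c ⌋ ∨ ⌊ b ≟ d ⌋)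
      share (inj₁ refl) (inj₁ x≡c) = T-∨⁺ ⌊ a ≟ c ⌋ (inj₁ (fromWitness x≡c))
      share (inj₁ refl) (inj₂ x≡d) = T-∨⁺ ⌊ a ≟ c ⌋ (inj₂ (T-∨⁺ ⌊ a ≟ d ⌋ (inj₁ (fromWitness x≡d))))
      share (inj₂ refl) (inj₁ x≡c) = via-b (T-∨⁺ ⌊ b ≟ c ⌋ (inj₁ (fromWitness x≡c)))
      share (inj₂ refl) (inj₂ x≡d) = via-b (T-∨⁺ ⌊ b ≟ c ⌋ (inj₂ (fromWitness x≡d)))

  star-clique : ∀ {w f g} → T (star w f) → T (star w g) → f ≢ g → T (adj L f g)
  star-clique {w} w∈f w∈g f≢g = Equivalence.from adjacent⇔ (f≢g , w , toWitness w∈f , toWitness w∈g)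

  adjacent⇒star : ∀ {e f} → T (adj L e f) → T (star (proj₁ (ends e)) f) ⊎ T (star (proj₂ (ends e)) f)
  adjacent⇒star adj-ef with Equivalence.to adjacent⇔ adj-ef
  ... | _ , _ , inj₁ refl , x∈f = inj₁ (fromWitness x∈f)
  ... | _ , _ , inj₂ refl , x∈f = inj₂ (fromWitness x∈f)

  adjacent-outside-star : ∀ {w f g} → T (star w f) → T (adj L f g) → ¬ w ∈ₚ ends g →
    ends f ∈ₗ joins w (ends g)
  adjacent-outside-star {w} {f} {g} w∈f adj-fg w∉g with Equivalence.to adjacent⇔ adj-fg
  ... | _ , x , x∈f , x∈g
      with ∈ₚ-both (λ w≡x → w∉g (subst (_∈ₚ ends g) (sym w≡x) x∈g)) (toWitness w∈f) x∈f | x∈g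
  ...   | inj₁ f≡wx | inj₁ refl = here f≡wx
  ...   | inj₂ f≡xw | inj₁ refl = there (here f≡xw)
  ...   | inj₁ f≡wx | inj₂ refl = there (there (here f≡wx))
  ...   | inj₂ f≡xw | inj₂ refl = there (there (there (here f≡xw)))

  -- starSize w is the degree d(w) of w in G, and outsideDeg w f is r_w(f).
  starSize : V → ℕ
  starSize w = count (star w)

  outsideDeg : V → E → ℕ
  outsideDeg w f = count (λ g → adj L f g ∧ not (star w g))

  deg≡starSize+outsideDeg : ∀ {w f} → T (star w f) → suc (deg L f) ≡ starSize w + outsideDeg w f
  deg≡starSize+outsideDeg {w} {f} w∈f = begin
    suc (deg L f)
      ≡⟨ cong suc (trans (∣tabulate∣≡count (adj L f)) (count-split (adj L f) (star w))) ⟩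
    suc (count (λ g → adj L f g ∧ star w g) + outsideDeg w f)
      ≡⟨ cong (λ x → suc (x + outsideDeg w f)) (count-cong inside⇒ ⇒inside) ⟩
    suc (count (λ g → star w g ∧ not ⌊ g ≟ f ⌋)) + outsideDeg w f
      ≡⟨ cong (_+ outsideDeg w f) (count-remove f w∈f) ⟨
    starSize w + outsideDeg w f
      ∎
    where
    open ≡-Reasoning
    inside⇒ : ∀ g → T (adj L f g ∧ star w g) → T (star w g ∧ not ⌊ g ≟ f ⌋)
    inside⇒ g fg with T-∧⁻ (adj L f g) fg
    ... | adj-fg , w∈g = T-∧⁺ (star w g) (w∈g , fromWitnessFalse (f≢g ∘ sym))
      where f≢g = proj₁ (Equivalence.to adjacent⇔ adj-fg)
    ⇒inside : ∀ g → T (star w g ∧ not ⌊ g ≟ f ⌋) → T (adj L f g ∧ star w g)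
    ⇒inside g wg with T-∧⁻ (star w g) wg
    ... | w∈g , g≢f = T-∧⁺ (adj L f g) (star-clique w∈f w∈g (toWitnessFalse g≢f ∘ sym) , w∈g)

  ∑outsideDeg-≤ : ∀ w → ∑[ f < numEdges G ] (indicator (star w f) * outsideDeg w f) ≤ numEdges G * 4
  ∑outsideDeg-≤ w = begin
    ∑[ f < N ] (indicator (star w f) * outsideDeg w f)
      ≡⟨ sum-cong-≗ (λ f → indicator-*-count (star w f) (λ g → adj L f g ∧ not (star w g))) ⟩
    ∑[ f < N ] ∑[ g < N ] indicator (crossing f g)
      ≡⟨ ∑-comm (λ f g → indicator (crossing f g)) ⟩
    ∑[ g < N ] count (λ f → crossing f g)
      ≤⟨ sum-mono (λ g → count-≤-length (≡-dec _≟_ _≟_) ends ends-injective _ (candidates g)) ⟩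
    ∑[ g < N ] 4
      ≡⟨ sum-const N 4 ⟩
    N * 4
      ∎
    where
    open ≤-Reasoning
    N = numEdges G
    crossing : E → E → Bool
    crossing f g = star w f ∧ (adj L f g ∧ not (star w g))
    candidates : ∀ g f → T (crossing f g) → ends f ∈ₗ joins w (ends g)
    candidates g f cross with T-∧⁻ (star w f) cross
    ... | w∈f , fg with T-∧⁻ (adj L f g) fg
    ...   | adj-fg , w∉g = adjacent-outside-star w∈f adj-fg (toWitnessFalse w∉g)

  starSize-bound : ∀ {B} → (∀ i → count (λ f → deg L f ≡ᵇ i) ≤ B) →
                   ∀ w t → t * starSize w ≤ t * (t * B) + numEdges G * 4
  starSize-bound {B} classes w t = begin
    t * starSize w                      ≡⟨ cong (t *_) (count-split (star w) (λ f → outsideDeg w f <ᵇ t)) ⟩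
    t * (count few + count many)        ≡⟨ *-distribˡ-+ t (count few) (count many) ⟩
    t * count few + t * count many      ≤⟨ +-mono-≤ (*-monoʳ-≤ t few-bound) many-bound ⟩
    t * (t * B) + numEdges G * 4        ∎
    where
    open ≤-Reasoning
    few many : E → Bool
    few  f = star w f ∧ (outsideDeg w f <ᵇ t)
    many f = star w f ∧ not (outsideDeg w f <ᵇ t)
    layer : ∀ s → count (λ f → star w f ∧ (outsideDeg w f ≡ᵇ s)) ≤ B
    layer s = ≤-trans (count-mono inClass) (classes (pred (starSize w + s)))
      where
      inClass : ∀ f → T (star w f ∧ (outsideDeg w f ≡ᵇ s)) → T (deg L f ≡ᵇ pred (starSize w + s))
      inClass f fs with T-∧⁻ (star w f) fs
      ... | w∈f , out≡s = ≡⇒≡ᵇ _ _ (cong pred 1+deg≡)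
        where
        1+deg≡ : suc (deg L f) ≡ starSize w + s
        1+deg≡ = trans (deg≡starSize+outsideDeg w∈f) (cong (starSize w +_) (≡ᵇ⇒≡ _ _ out≡s))
    few-bound : count few ≤ t * B
    few-bound = count-<-layers (star w) (outsideDeg w) layer t
    many-bound : t * count many ≤ numEdges G * 4
    many-bound = ≤-trans (count-≥-markov (star w) (outsideDeg w) t) (∑outsideDeg-≤ w)

  deg-≤-starSizes : ∀ e → let (u , v) = ends e in 2 + deg L e ≤ starSize u + starSize v
  deg-≤-starSizes e = begin
    2 + deg L e
      ≡⟨ cong (2 +_) (∣tabulate∣≡count (adj L e)) ⟩
    2 + count (adj L e)
      ≤⟨ s≤s (s≤s (≤-trans (count-mono cover) (count-∨ (others u) (others v)))) ⟩
    2 + (count (others u) + count (others v))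
      ≡⟨ cong suc (+-suc (count (others u)) (count (others v))) ⟨
    suc (count (others u)) + suc (count (others v))
      ≡⟨ cong₂ _+_ (count-remove e (fromWitness (inj₁ refl))) (count-remove e (fromWitness (inj₂ refl))) ⟨
    starSize u + starSize v
      ∎
    where
    open ≤-Reasoning
    u = proj₁ (ends e)
    v = proj₂ (ends e)
    others : V → E → Bool
    others w f = star w f ∧ not ⌊ f ≟ e ⌋
    cover : ∀ f → T (adj L e f) → T (others u f ∨ others v f)
    cover f adj-ef with e≢f , _ ← Equivalence.to adjacent⇔ adj-ef | adjacent⇒star adj-ef
    ... | inj₁ u∈f = T-∨⁺ (others u f) (inj₁ (T-∧⁺ (star u f) (u∈f , f≢e)))
      where f≢e = fromWitnessFalse (e≢f ∘ sym)
    ... | inj₂ v∈f = T-∨⁺ (others u f) (inj₂ (T-∧⁺ (star v f) (v∈f , f≢e)))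
      where f≢e = fromWitnessFalse (e≢f ∘ sym)

  edges-≤-cube : ∀ {B} → (∀ i → count (λ f → deg L f ≡ᵇ i) ≤ B) →
                 ∀ e → (∀ f → deg L f ≤ deg L e) → numEdges G ≤ 64 * (B * B * B)
  edges-≤-cube {B} classes e maximal = cube-bound {B = B} edges-≤ stars
    where
    open ≤-Reasoning
    N = numEdges G
    t = 16 * B
    u = proj₁ (ends e)
    v = proj₂ (ends e)
    edges-≤ : N ≤ suc (deg L e) * B
    edges-≤ = size-≤-layers (deg L) maximal classes
    regroup : ∀ B N → (16 * B * (16 * B * B) + N * 4) + (16 * B * (16 * B * B) + N * 4) ≡
                      512 * (B * B * B) + 8 * N
    regroup = solve-∀
    stars : t * (2 + deg L e) ≤ 512 * (B * B * B) + 8 * N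
    stars = begin
      t * (2 + deg L e)                              ≤⟨ *-monoʳ-≤ t (deg-≤-starSizes e) ⟩
      t * (starSize u + starSize v)                  ≡⟨ *-distribˡ-+ t (starSize u) (starSize v) ⟩
      t * starSize u + t * starSize v                ≤⟨ +-mono-≤ (starSize-bound classes u t)
                                                                  (starSize-bound classes v t) ⟩
      (t * (t * B) + N * 4) + (t * (t * B) + N * 4)  ≡⟨ regroup B N ⟩
      512 * (B * B * B) + 8 * N                      ∎

theorem4p1 : (G : Graph) (k c a : ℕ) →
    IsChiK (lineGraph G) k c → IsAlphaKReg (lineGraph G) k a →
    numEdges G ≤ (4 * c * a) ^ 3
theorem4p1 G k c a ((_ , colouring) , _) (_ , α-max) with maximum-or-empty (deg (lineGraph G))
... | inj₁ noEdges   = subst (_≤ (4 * c * a) ^ 3) (sym noEdges) z≤n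
... | inj₂ (e , max) = subst (numEdges G ≤_) (cube c a)
                         (edges-≤-cube G (degreeClass-bound (lineGraph G) colouring α-max) e max)
  where
  cube : ∀ c a → 64 * (c * a * (c * a) * (c * a)) ≡ (4 * c * a) ^ 3
  cube = expanded
    where
    expanded : ∀ c a → 64 * (c * a * (c * a) * (c * a)) ≡ 4 * c * a * (4 * c * a * (4 * c * a * 1))
    expanded = solve-∀
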